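{- Let $\beta=\frac{1+\sqrt5}{2}$ and for each positive integer $n$ with Zeckendorf expansion $n=\sum_{j\ge0}\epsilon_jF_{j+2}$ let $\delta(n)=\frac1{\sqrt5}\sum_{j\ge0}\epsilon_j\beta^{j+2}$. Then for every positive integer $n$, $$\delta(n)=n-\frac{\{\beta n\}-1+f(n)}{\sqrt5},$$ where $\{x\}$ denotes the fractional part of $x$.
   Context: Fibonacci numbers: $F_0=0,F_1=1,F_n=F_{n-1}+F_{n-2}$. Zeckendorf expansion: every positive integer $n$ is uniquely $n=\sum_{j\ge0}\epsilon_jF_{j+2}$ with $\epsilon_j\in\{0,1\}$, finitely many nonzero, $\epsilon_j\epsilon_{j+1}=0$. The sequence $(f(n))_{n\ge1}$ is the infinite Fibonacci word $f(1)f(2)f(3)\dots=0100101001001\dots$, the fixed point of the morphism $0\mapsto01$, $1\mapsto0$. -}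

module Defs where

open import Data.Nat using (ℕ; zero; suc)
open import Data.Integer using (ℤ; +_)
open import Data.Rational using (ℚ; 0ℚ; 1ℚ; ½; _/_; _≤_; _<_)
  renaming (_+_ to _+q_; _*_ to _*q_; -_ to -q_)
open import Data.List using (List; []; _∷_; _++_; concatMap)
open import Data.Bool using (Bool; true; false)
open import Data.Product using (_×_)
open import Data.Sum using (_⊎_)
open import Relation.Binary.PropositionalEquality using (_≡_)
open import Relation.Nullary using (¬_)

fib : ℕ → ℕ
fib zero = 0
fib (suc zero) = 1
fib (suc (suc n)) = fib (suc n) Data.Nat.+ fib n

-- Zeckendorf digits: a list ε₀ ε₁ … of booleans, value Σ εⱼ F_{j+2}

bit : Bool → ℕ
bit true = 1
bit false = 0

zvalFrom : ℕ → List Bool → ℕ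
zvalFrom j [] = 0
zvalFrom j (e ∷ es) = bit e Data.Nat.* fib (suc (suc j)) Data.Nat.+ zvalFrom (suc j) es

zval : List Bool → ℕ
zval = zvalFrom 0

NoAdj11 : List Bool → Set
NoAdj11 [] = Data.Unit.⊤ where import Data.Unit
NoAdj11 (e ∷ []) = Data.Unit.⊤ where import Data.Unit
NoAdj11 (true ∷ true ∷ es) = Data.Empty.⊥ where import Data.Empty
NoAdj11 (true ∷ false ∷ es) = NoAdj11 (false ∷ es)
NoAdj11 (false ∷ e ∷ es) = NoAdj11 (e ∷ es)

IsZeckendorf : ℕ → List Bool → Set
IsZeckendorf n ε = NoAdj11 ε × zval ε ≡ n

-- The field ℚ(√5): a + b√5 represented by the pair (a , b)

record Q5 : Set where
  constructor _⊕_√5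
  field
    ra : ℚ
    rb : ℚ
open Q5 public

infixl 6 _+₅_ _-₅_
infixl 7 _*₅_

_+₅_ : Q5 → Q5 → Q5
(a ⊕ b √5) +₅ (c ⊕ d √5) = (a +q c) ⊕ (b +q d) √5

neg₅ : Q5 → Q5
neg₅ (a ⊕ b √5) = (-q a) ⊕ (-q b) √5

_-₅_ : Q5 → Q5 → Q5
x -₅ y = x +₅ neg₅ y

_*₅_ : Q5 → Q5 → Q5
(a ⊕ b √5) *₅ (c ⊕ d √5) =
  ((a *q c) +q ((+ 5 / 1) *q (b *q d))) ⊕ ((a *q d) +q (b *q c)) √5

0₅ : Q5
0₅ = 0ℚ ⊕ 0ℚ √5

1₅ : Q5
1₅ = 1ℚ ⊕ 0ℚ √5

ℤ→Q5 : ℤ → Q5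
ℤ→Q5 k = (k / 1) ⊕ 0ℚ √5

ℕ→Q5 : ℕ → Q5
ℕ→Q5 n = ℤ→Q5 (+ n)

-- division by √5: (a + b√5)/√5 = b + (a/5)√5
div√5 : Q5 → Q5
div√5 (a ⊕ b √5) = b ⊕ (a *q (+ 1 / 5)) √5

β : Q5
β = ½ ⊕ ½ √5

_^₅_ : Q5 → ℕ → Q5
x ^₅ zero = 1₅
x ^₅ suc k = x *₅ (x ^₅ k)

-- order on ℚ(√5) (the real embedding): a + b√5 ≥ 0
NonNeg₅ : Q5 → Set
NonNeg₅ (a ⊕ b √5) =
  (0ℚ ≤ a × 0ℚ ≤ b)
  ⊎ (0ℚ ≤ a × b < 0ℚ × ((+ 5 / 1) *q (b *q b)) ≤ (a *q a))
  ⊎ (a < 0ℚ × 0ℚ ≤ b × (a *q a) ≤ ((+ 5 / 1) *q (b *q b)))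

_≤₅_ : Q5 → Q5 → Set
x ≤₅ y = NonNeg₅ (y -₅ x)

_<₅_ : Q5 → Q5 → Set
x <₅ y = x ≤₅ y × ¬ (x ≡ y)

betaSumFrom : ℕ → List Bool → Q5
betaSumFrom j [] = 0₅
betaSumFrom j (true ∷ es) = (β ^₅ suc (suc j)) +₅ betaSumFrom (suc j) es
betaSumFrom j (false ∷ es) = betaSumFrom (suc j) es

δ : List Bool → Q5
δ ε = div√5 (betaSumFrom 0 ε)

-- The Fibonacci word f(1) f(2) … = 0100101001001…, fixed point of
-- σ : 0 ↦ 01, 1 ↦ 0.  σᵏ(0) is a prefix of the fixed point of length F_{k+2}.

σ : ℕ → List ℕ
σ zero = 0 ∷ 1 ∷ []
σ (suc _) = 0 ∷ []

σ^ : ℕ → List ℕ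
σ^ zero = 0 ∷ []
σ^ (suc k) = concatMap σ (σ^ k)

-- 0-indexed lookup with default 0
nth : List ℕ → ℕ → ℕ
nth [] _ = 0
nth (x ∷ xs) zero = x
nth (x ∷ xs) (suc i) = nth xs i

-- f(n) for n ≥ 1 (1-indexed): the n-th letter of σⁿ(0), whose length F_{n+2} ≥ n
fword : ℕ → ℕ
fword zero = 0
fword (suc i) = nth (σ^ (suc i)) i

-- Write n = Σ εⱼ F_{j+2} and P = Σ εⱼ F_{j+1}. Since β^{j+2} = F_{j+2} β + F_{j+1}, the sum
-- Σ εⱼ β^{j+2} equals nβ + P, and the identity becomes ⌊βn⌋ = n + P + f(n) − 1, i.e.
-- ⌊n/β⌋ = P + f(n) − 1.
--
-- A new lowest digit 0 or 1 maps (n, P) to (n + P, n) or (n + P + 1, n + 1). Since β² = β + 1,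
-- both maps preserve P = ⌊(n + 1)/β⌋, and the same computation gives ⌊n/β⌋ = P − 1 + f, where f is
-- the parity of the number of trailing zero digits; squaring turns every comparison with u/β into
-- one between integers. The hypothesis k ≤ βn < k + 1 squares to integer inequalities in the same
-- way, which pin k down as n + ⌊n/β⌋.
--
-- That parity is f(n): the blocks σᵏ(0) of length F_{k+2} satisfy σ^{k+2}(0) = σ^{k+1}(0) σᵏ(0),
-- so the last letter of σᵏ(0) is k mod 2, and adding a Zeckendorf number whose digits all lie
-- above position k leaves the first F_{k+2} letters of the Fibonacci word unchanged.

module Submission where

module Zeckendorf where
  open import Defs
  open import Data.Nat
  open import Data.Nat.Properties
  open import Data.Nat.Tactic.RingSolver using (solve-∀)
  open import Data.List using (List; []; _∷_)
  open import Data.Bool using (Bool; true; false)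
  open import Data.Sum using (_⊎_; inj₁; inj₂)
  open import Relation.Binary.PropositionalEquality
  open ≡-Reasoning

  fib-suc-mono : ∀ n → fib (suc n) ≤ fib (suc (suc n))
  fib-suc-mono n = m≤m+n (fib (suc n)) (fib n)

  fib-mono : ∀ {m n} → m ≤′ n → fib (suc m) ≤ fib (suc n)
  fib-mono {m} ≤′-refl = ≤-refl {fib (suc m)}
  fib-mono (≤′-step {n} m≤′n) = ≤-trans (fib-mono m≤′n) (fib-suc-mono n)

  1≤fib-suc : ∀ n → 1 ≤ fib (suc n)
  1≤fib-suc n = fib-mono {0} {n} (≤⇒≤′ z≤n)

  n<fib[2+n] : ∀ n → n < fib (suc (suc n))
  n<fib[2+n] zero = s≤s z≤n
  n<fib[2+n] (suc n) = subst (_< fib (3 + n)) (+-comm n 1) (+-mono-<-≤ (n<fib[2+n] n) (1≤fib-suc n))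

  fibShiftFrom : ℕ → List Bool → ℕ
  fibShiftFrom j [] = 0
  fibShiftFrom j (e ∷ es) = bit e * fib (suc j) + fibShiftFrom (suc j) es

  fibShift : List Bool → ℕ
  fibShift = fibShiftFrom 0

  fibShiftFrom-suc : ∀ j es → fibShiftFrom (suc j) es ≡ zvalFrom j es
  fibShiftFrom-suc j [] = refl
  fibShiftFrom-suc j (e ∷ es) = cong (bit e * fib (suc (suc j)) +_) (fibShiftFrom-suc (suc j) es)

  zvalFrom-suc : ∀ j es → zvalFrom (suc j) es ≡ zvalFrom j es + fibShiftFrom j es
  zvalFrom-suc j [] = refl
  zvalFrom-suc j (e ∷ es) = begin
    b * (F₂ + F₁) + zvalFrom (suc (suc j)) es  ≡⟨ cong (b * (F₂ + F₁) +_) (zvalFrom-suc (suc j) es) ⟩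
    b * (F₂ + F₁) + (Z + P)                    ≡⟨ interchange b F₂ F₁ Z P ⟩
    (b * F₂ + Z) + (b * F₁ + P)                ∎
    where
    b = bit e
    F₂ = fib (suc (suc j))
    F₁ = fib (suc j)
    Z = zvalFrom (suc j) es
    P = fibShiftFrom (suc j) es
    interchange : ∀ b x y z p → b * (x + y) + (z + p) ≡ (b * x + z) + (b * y + p)
    interchange = solve-∀

  1≤zvalFrom-suc⇒1≤zvalFrom : ∀ j es → 1 ≤ zvalFrom (suc j) es → 1 ≤ zvalFrom j es
  1≤zvalFrom-suc⇒1≤zvalFrom j (true ∷ es) _ =
    ≤-trans (1≤fib-suc (suc j)) (≤-trans (≤-reflexive (sym (*-identityˡ _))) (m≤m+n _ _))
  1≤zvalFrom-suc⇒1≤zvalFrom j (false ∷ es) 1≤n = 1≤zvalFrom-suc⇒1≤zvalFrom (suc j) es 1≤n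

  NoAdj11-tail : ∀ {e} es → NoAdj11 (e ∷ es) → NoAdj11 es
  NoAdj11-tail {e} [] _ = _
  NoAdj11-tail {true} (false ∷ es) p = p
  NoAdj11-tail {false} (_ ∷ es) p = p

  lowZeros : List Bool → ℕ
  lowZeros [] = 0
  lowZeros (true ∷ _) = 0
  lowZeros (false ∷ es) = suc (lowZeros es)

  [1+n]%2≡1∸n%2 : ∀ n → suc n % 2 ≡ 1 ∸ n % 2
  [1+n]%2≡1∸n%2 zero = refl
  [1+n]%2≡1∸n%2 (suc zero) = refl
  [1+n]%2≡1∸n%2 (suc (suc n)) = [1+n]%2≡1∸n%2 n

  n%2≡0⊎n%2≡1 : ∀ n → n % 2 ≡ 0 ⊎ n % 2 ≡ 1
  n%2≡0⊎n%2≡1 zero = inj₁ refl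
  n%2≡0⊎n%2≡1 (suc zero) = inj₂ refl
  n%2≡0⊎n%2≡1 (suc (suc n)) = n%2≡0⊎n%2≡1 n

module FibonacciWord where
  open import Defs
  open Zeckendorf
  open import Data.Nat
  open import Data.Nat.Properties
  open import Data.List using (List; []; _∷_; _++_; length; concat; concatMap; map)
  open import Data.List.Properties using (length-++; map-++; concat-++)
  open import Data.Nat.Tactic.RingSolver using (solve-∀)
  open import Data.Bool using (true; false)
  open import Data.Sum using (inj₁; inj₂)
  open import Relation.Binary.PropositionalEquality
  open ≡-Reasoning

  concatMap-++ : ∀ {A B : Set} (f : A → List B) xs ys →
    concatMap f (xs ++ ys) ≡ concatMap f xs ++ concatMap f ys
  concatMap-++ f xs ys = trans (cong concat (map-++ f xs ys)) (sym (concat-++ (map f xs) (map f ys)))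

  σ^-suc-suc : ∀ k → σ^ (suc (suc k)) ≡ σ^ (suc k) ++ σ^ k
  σ^-suc-suc zero = refl
  σ^-suc-suc (suc k) = trans (cong (concatMap σ) (σ^-suc-suc k)) (concatMap-++ σ (σ^ (suc k)) (σ^ k))

  length-σ^ : ∀ k → length (σ^ k) ≡ fib (suc (suc k))
  length-σ^ zero = refl
  length-σ^ (suc zero) = refl
  length-σ^ (suc (suc k)) = begin
    length (σ^ (suc (suc k)))            ≡⟨ cong length (σ^-suc-suc k) ⟩
    length (σ^ (suc k) ++ σ^ k)          ≡⟨ length-++ (σ^ (suc k)) ⟩
    length (σ^ (suc k)) + length (σ^ k)  ≡⟨ cong₂ _+_ (length-σ^ (suc k)) (length-σ^ k) ⟩
    fib (suc (suc (suc (suc k))))        ∎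

  nth-++ˡ : ∀ xs ys {i} → i < length xs → nth (xs ++ ys) i ≡ nth xs i
  nth-++ˡ (x ∷ xs) ys {zero} _ = refl
  nth-++ˡ (x ∷ xs) ys {suc i} (s≤s i<n) = nth-++ˡ xs ys i<n

  nth-++ʳ : ∀ xs ys i → nth (xs ++ ys) (length xs + i) ≡ nth ys i
  nth-++ʳ [] ys i = refl
  nth-++ʳ (x ∷ xs) ys i = nth-++ʳ xs ys i

  nth-σ^-suc : ∀ k {i} → i < fib (suc (suc k)) → nth (σ^ (suc k)) i ≡ nth (σ^ k) i
  nth-σ^-suc zero {zero} _ = refl
  nth-σ^-suc zero {suc i} (s≤s ())
  nth-σ^-suc (suc k) {i} i<F = begin
    nth (σ^ (suc (suc k))) i       ≡⟨ cong (λ w → nth w i) (σ^-suc-suc k) ⟩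
    nth (σ^ (suc k) ++ σ^ k) i     ≡⟨ nth-++ˡ (σ^ (suc k)) (σ^ k) (subst (i <_) (sym (length-σ^ (suc k))) i<F) ⟩
    nth (σ^ (suc k)) i             ∎

  nth-σ^-stable : ∀ {k m i} → k ≤′ m → i < fib (suc (suc k)) → nth (σ^ m) i ≡ nth (σ^ k) i
  nth-σ^-stable ≤′-refl _ = refl
  nth-σ^-stable (≤′-step {m} k≤′m) i<F =
    trans (nth-σ^-suc m (<-≤-trans i<F (fib-mono (s≤′s k≤′m)))) (nth-σ^-stable k≤′m i<F)

  fword-nth-σ^ : ∀ k {i} → i < fib (suc (suc k)) → fword (suc i) ≡ nth (σ^ k) i
  fword-nth-σ^ k {i} i<F with ≤-total k (suc i)
  ... | inj₁ k≤1+i = nth-σ^-stable (≤⇒≤′ k≤1+i) i<F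
  ... | inj₂ 1+i≤k = sym (nth-σ^-stable (≤⇒≤′ 1+i≤k) (<-trans (n<1+n i) (n<fib[2+n] (suc i))))

  suc[fib∸1]≡fib : ∀ k → suc (fib (suc k) ∸ 1) ≡ fib (suc k)
  suc[fib∸1]≡fib k = m+[n∸m]≡n (1≤fib-suc k)

  nth-σ^-last : ∀ k → nth (σ^ k) (fib (suc (suc k)) ∸ 1) ≡ k % 2
  nth-σ^-last zero = refl
  nth-σ^-last (suc zero) = refl
  nth-σ^-last (suc (suc k)) = begin
    nth (σ^ (suc (suc k))) (F₃ + F₂ ∸ 1)                ≡⟨ cong₂ nth (σ^-suc-suc k) index ⟩
    nth (σ^ (suc k) ++ σ^ k) (length (σ^ (suc k)) + (F₂ ∸ 1))  ≡⟨ nth-++ʳ (σ^ (suc k)) (σ^ k) (F₂ ∸ 1) ⟩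
    nth (σ^ k) (F₂ ∸ 1)                                  ≡⟨ nth-σ^-last k ⟩
    k % 2                                                ∎
    where
    F₃ = fib (suc (suc (suc k)))
    F₂ = fib (suc (suc k))
    index : F₃ + F₂ ∸ 1 ≡ length (σ^ (suc k)) + (F₂ ∸ 1)
    index = trans (+-∸-assoc F₃ (1≤fib-suc (suc k))) (cong (_+ (F₂ ∸ 1)) (sym (length-σ^ (suc k))))

  fword-fib : ∀ k → fword (fib (suc (suc k))) ≡ k % 2
  fword-fib k = begin
    fword F₂                ≡⟨ cong fword (sym (suc[fib∸1]≡fib (suc k))) ⟩
    fword (suc (F₂ ∸ 1))    ≡⟨ fword-nth-σ^ k (≤-reflexive (suc[fib∸1]≡fib (suc k))) ⟩
    nth (σ^ k) (F₂ ∸ 1)     ≡⟨ nth-σ^-last k ⟩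
    k % 2                   ∎
    where F₂ = fib (suc (suc k))

  fword-fib-+ : ∀ k {i} → i < fib (suc (suc k)) →
    fword (fib (suc (suc (suc k))) + suc i) ≡ fword (suc i)
  fword-fib-+ k {i} i<F₂ = begin
    fword (F₃ + suc i)                             ≡⟨ cong fword (+-suc F₃ i) ⟩
    fword (suc (F₃ + i))                           ≡⟨ fword-nth-σ^ (suc (suc k)) (+-monoʳ-< F₃ i<F₂) ⟩
    nth (σ^ (suc (suc k))) (F₃ + i)                ≡⟨ cong₂ nth (σ^-suc-suc k) (cong (_+ i) (sym (length-σ^ (suc k)))) ⟩
    nth (σ^ (suc k) ++ σ^ k) (length (σ^ (suc k)) + i)  ≡⟨ nth-++ʳ (σ^ (suc k)) (σ^ k) i ⟩
    nth (σ^ k) i                                   ≡⟨ fword-nth-σ^ k i<F₂ ⟨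
    fword (suc i)                                  ∎
    where F₃ = fib (suc (suc (suc k)))

  fword-zvalFrom-+ : ∀ j es → NoAdj11 es → ∀ {i} → i < fib (suc (suc j)) →
    fword (zvalFrom (suc j) es + suc i) ≡ fword (suc i)
  fword-zvalFrom-+ j [] _ _ = refl
  fword-zvalFrom-+ j (false ∷ es) p i<F₂ =
    fword-zvalFrom-+ (suc j) es (NoAdj11-tail es p) (<-≤-trans i<F₂ (fib-suc-mono (suc j)))
  fword-zvalFrom-+ j (true ∷ []) _ {i} i<F₂ =
    trans (cong (λ x → fword (x + suc i)) (trans (+-identityʳ (1 * F₃)) (*-identityˡ F₃))) (fword-fib-+ j i<F₂)
    where F₃ = fib (suc (suc (suc j)))
  fword-zvalFrom-+ j (true ∷ false ∷ es) p {i} i<F₂ = begin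
    fword ((1 * F₃ + R) + suc i)   ≡⟨ cong fword (rearrange F₃ R i) ⟩
    fword (R + suc (F₃ + i))       ≡⟨ fword-zvalFrom-+ (suc (suc j)) es (NoAdj11-tail es p) (+-monoʳ-< F₃ i<F₂) ⟩
    fword (suc (F₃ + i))           ≡⟨ cong fword (+-suc F₃ i) ⟨
    fword (F₃ + suc i)             ≡⟨ fword-fib-+ j i<F₂ ⟩
    fword (suc i)                  ∎
    where
    F₃ = fib (suc (suc (suc j)))
    R = zvalFrom (suc (suc (suc j))) es
    rearrange : ∀ a r i → (1 * a + r) + (1 + i) ≡ r + (1 + (a + i))
    rearrange = solve-∀

  fword-zvalFrom : ∀ j es → NoAdj11 es → 1 ≤ zvalFrom j es → fword (zvalFrom j es) ≡ (j + lowZeros es) % 2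
  fword-zvalFrom j (false ∷ es) p 1≤n =
    trans (fword-zvalFrom (suc j) es (NoAdj11-tail es p) 1≤n) (cong (_% 2) (sym (+-suc j (lowZeros es))))
  fword-zvalFrom j (true ∷ []) _ _ = begin
    fword (1 * F₂ + 0)    ≡⟨ cong fword (trans (+-identityʳ (1 * F₂)) (*-identityˡ F₂)) ⟩
    fword F₂              ≡⟨ fword-fib j ⟩
    j % 2                 ≡⟨ cong (_% 2) (+-identityʳ j) ⟨
    (j + 0) % 2           ∎
    where F₂ = fib (suc (suc j))
  fword-zvalFrom j (true ∷ false ∷ es) p _ = begin
    fword (1 * F₂ + R)          ≡⟨ cong fword F₂+R≡R+suc[F₂∸1] ⟩
    fword (R + suc (F₂ ∸ 1))    ≡⟨ fword-zvalFrom-+ (suc j) es (NoAdj11-tail es p) (≤-trans (≤-reflexive (suc[fib∸1]≡fib (suc j))) (fib-suc-mono (suc j))) ⟩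
    fword (suc (F₂ ∸ 1))        ≡⟨ cong fword (suc[fib∸1]≡fib (suc j)) ⟩
    fword F₂                    ≡⟨ fword-fib j ⟩
    j % 2                       ≡⟨ cong (_% 2) (+-identityʳ j) ⟨
    (j + 0) % 2                 ∎
    where
    F₂ = fib (suc (suc j))
    R = zvalFrom (suc (suc j)) es
    F₂+R≡R+suc[F₂∸1] : 1 * F₂ + R ≡ R + suc (F₂ ∸ 1)
    F₂+R≡R+suc[F₂∸1] = trans (cong (_+ R) (*-identityˡ F₂))
      (trans (+-comm F₂ R) (cong (R +_) (sym (suc[fib∸1]≡fib (suc j)))))

module Beatty where
  open import Defs
  open Zeckendorf
  open import Data.Nat
  open import Data.Nat.Properties
  open import Data.Nat.Tactic.RingSolver using (solve-∀)
  open import Data.List using ([]; _∷_)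
  open import Data.Bool using (true; false)
  open import Data.Product using (Σ-syntax; _×_; _,_)
  open import Data.Sum using (_⊎_; inj₁; inj₂)
  open import Relation.Nullary.Decidable using (from-yes)
  open import Relation.Binary.PropositionalEquality

  +-<-transfer : ∀ {a b c d} → a + d ≤ c + b → b < d → a < c
  +-<-transfer a+d≤c+b b<d = ≰⇒> λ c≤a → <⇒≱ (+-mono-≤-< c≤a b<d) a+d≤c+b

  +-≤-transfer : ∀ {a b c d} → a + d ≤ c + b → b ≤ d → a ≤ c
  +-≤-transfer a+d≤c+b b≤d = ≮⇒≥ λ c<a → <⇒≱ (+-mono-<-≤ c<a b≤d) a+d≤c+b

  m*m≤n*n⇒m≤n : ∀ {m n} → m * m ≤ n * n → m ≤ n
  m*m≤n*n⇒m≤n m*m≤n*n = ≮⇒≥ λ n<m → <⇒≱ (*-mono-< n<m n<m) m*m≤n*n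

  m*m<n*n⇒m<n : ∀ {m n} → m * m < n * n → m < n
  m*m<n*n⇒m<n m*m<n*n = ≰⇒> λ n≤m → <⇒≱ m*m<n*n (*-mono-≤ n≤m n≤m)

  -- v < u/β and u/β < v; as 2u/β = (√5 − 1)u, v < u/β iff 2v + u < √5 u.
  _<_/β : ℕ → ℕ → Set
  v < u /β = (2 * v + u) * (2 * v + u) < 5 * (u * u)

  _/β<_ : ℕ → ℕ → Set
  u /β< v = 5 * (u * u) < (2 * v + u) * (2 * v + u)

  ⌊_/β⌋≡_ : ℕ → ℕ → Set
  ⌊ u /β⌋≡ q = q < u /β × u /β< suc q

  flip-<-/β : ∀ u v → v < u /β → (u + v) /β< u
  flip-<-/β u v = +-<-transfer (≤-reflexive (identity u v))
    where
    identity : ∀ u v → 5 * ((u + v) * (u + v)) + 5 * (u * u)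
                      ≡ (2 * u + (u + v)) * (2 * u + (u + v)) + (2 * v + u) * (2 * v + u)
    identity = solve-∀

  flip-/β-< : ∀ u v → u /β< v → u < (u + v) /β
  flip-/β-< u v = +-<-transfer (≤-reflexive (identity u v))
    where
    identity : ∀ u v → (2 * u + (u + v)) * (2 * u + (u + v)) + (2 * v + u) * (2 * v + u)
                      ≡ 5 * ((u + v) * (u + v)) + 5 * (u * u)
    identity = solve-∀

  -- Since √5 < 3, squaring shows w ≤ √5 u implies w + 1 ≤ √5 (u + 1) with room to spare.
  sq-suc-increment : ∀ w u → w * w ≤ 5 * (u * u) →
    suc w * suc w + 5 * (u * u) ≤ 5 * (suc u * suc u) + w * w
  sq-suc-increment w u w²≤5u² = begin
    suc w * suc w + 5 * (u * u)             ≡⟨ expand w u ⟩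
    (2 * w + 1) + (5 * (u * u) + w * w)     ≤⟨ +-monoˡ-≤ rest (+-monoˡ-≤ 1 (*-monoʳ-≤ 2 w≤3u)) ⟩
    (2 * (3 * u) + 1) + (5 * (u * u) + w * w) ≤⟨ +-monoˡ-≤ rest (m≤m+n (2 * (3 * u) + 1) (4 * u + 4)) ⟩
    (2 * (3 * u) + 1) + (4 * u + 4) + (5 * (u * u) + w * w) ≡⟨ collect w u ⟩
    5 * (suc u * suc u) + w * w             ∎
    where
    open ≤-Reasoning
    rest = 5 * (u * u) + w * w
    w≤3u : w ≤ 3 * u
    w≤3u = m*m≤n*n⇒m≤n (≤-trans w²≤5u² (≤-trans (*-monoˡ-≤ (u * u) {5} {9} (from-yes (5 ≤? 9)))
                                                   (≤-reflexive (square3 u))))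
      where
      square3 : ∀ u → 9 * (u * u) ≡ 3 * u * (3 * u)
      square3 = solve-∀
    expand : ∀ w u → (1 + w) * (1 + w) + 5 * (u * u) ≡ (2 * w + 1) + (5 * (u * u) + w * w)
    expand = solve-∀
    collect : ∀ w u → (2 * (3 * u) + 1) + (4 * u + 4) + (5 * (u * u) + w * w) ≡ 5 * ((1 + u) * (1 + u)) + w * w
    collect = solve-∀

  <-/β-suc : ∀ u v → v < u /β → v < suc u /β
  <-/β-suc u v v<u/β = subst (λ w → w * w < 5 * (suc u * suc u)) (sym (+-suc (2 * v) u))
    (+-<-transfer {d = 5 * (u * u)} (sq-suc-increment (2 * v + u) u (<⇒≤ v<u/β)) v<u/β)

  /β<-pred : ∀ u v → suc u /β< v → u /β< v
  /β<-pred u v 1+u/β<v = ≰⇒> λ w²≤5u² → <⇒≱ 1+u/β<v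
    (subst (λ w → w * w ≤ 5 * (suc u * suc u)) (sym (+-suc (2 * v) u))
      (+-≤-transfer {d = 5 * (u * u)} (sq-suc-increment (2 * v + u) u w²≤5u²) w²≤5u²))

  ⌊[1+n+q]/β⌋≡n : ∀ n q → ⌊ suc n /β⌋≡ q → ⌊ suc n + q /β⌋≡ n
  ⌊[1+n+q]/β⌋≡n n q (q<u/β , u/β<1+q) =
    subst (n <_/β) (+-suc n q) (flip-/β-< n (suc q) (/β<-pred n (suc q) u/β<1+q)) ,
    flip-<-/β (suc n) q q<u/β

  ⌊[u+1+q]/β⌋≡u : ∀ u q → ⌊ u /β⌋≡ q → ⌊ u + suc q /β⌋≡ u
  ⌊[u+1+q]/β⌋≡u u q (q<u/β , u/β<1+q) =
    flip-/β-< u (suc q) u/β<1+q ,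
    subst (_/β< suc u) (sym (+-suc u q)) (flip-<-/β (suc u) q (<-/β-suc u q q<u/β))

  ⌊1+zval/β⌋≡fibShift : ∀ es → ⌊ suc (zval es) /β⌋≡ fibShift es
  ⌊1+zval/β⌋≡fibShift [] = from-yes (1 <? 5) , from-yes (5 <? 9)
  ⌊1+zval/β⌋≡fibShift (false ∷ es) rewrite zvalFrom-suc 0 es | fibShiftFrom-suc 0 es =
    ⌊[1+n+q]/β⌋≡n (zval es) (fibShift es) (⌊1+zval/β⌋≡fibShift es)
  ⌊1+zval/β⌋≡fibShift (true ∷ es) rewrite zvalFrom-suc 0 es | fibShiftFrom-suc 0 es =
    subst (⌊_/β⌋≡ suc (zval es)) (cong suc (+-suc (zval es) (fibShift es)))
      (⌊[u+1+q]/β⌋≡u (suc (zval es)) (fibShift es) (⌊1+zval/β⌋≡fibShift es))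

  -- A new lowest digit 0 turns (n, P, f) into (n + P, n, 1 − f).
  ⌊/β⌋-shift : ∀ n P f q → 1 ≤ n → f ≡ 0 ⊎ f ≡ 1 → suc q ≡ f + P → ⌊ n /β⌋≡ q →
    Σ[ q′ ∈ ℕ ] suc q′ ≡ (1 ∸ f) + n × ⌊ n + P /β⌋≡ q′
  ⌊/β⌋-shift n .(suc q) .0 q _ (inj₁ refl) refl ⌊n/β⌋≡q = n , refl , ⌊[u+1+q]/β⌋≡u n q ⌊n/β⌋≡q
  ⌊/β⌋-shift (suc m) .q .1 q _ (inj₂ refl) refl ⌊n/β⌋≡q = m , refl , ⌊[1+n+q]/β⌋≡n m q ⌊n/β⌋≡q

  ⌊zval/β⌋ : ∀ es → 1 ≤ zval es →
    Σ[ q ∈ ℕ ] suc q ≡ lowZeros es % 2 + fibShift es × ⌊ zval es /β⌋≡ q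
  ⌊zval/β⌋ (true ∷ es) _ rewrite zvalFrom-suc 0 es | fibShiftFrom-suc 0 es =
    zval es , refl , ⌊[1+n+q]/β⌋≡n (zval es) (fibShift es) (⌊1+zval/β⌋≡fibShift es)
  ⌊zval/β⌋ (false ∷ es) 1≤n with 1≤zvalFrom-suc⇒1≤zvalFrom 0 es 1≤n
  ... | 1≤m with ⌊zval/β⌋ es 1≤m
  ... | q , 1+q≡f+P , ⌊n/β⌋≡q
    rewrite zvalFrom-suc 0 es | fibShiftFrom-suc 0 es | [1+n]%2≡1∸n%2 (lowZeros es) =
    ⌊/β⌋-shift (zval es) (fibShift es) (lowZeros es % 2) q 1≤m (n%2≡0⊎n%2≡1 (lowZeros es)) 1+q≡f+P ⌊n/β⌋≡q

module RationalEmbedding where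
  open import Data.Integer as ℤ using (ℤ; +_)
  import Data.Integer.Properties as ℤ
  open import Data.Integer.Tactic.RingSolver as ℤ-Solver using ()
  open import Data.Rational
  open import Data.Rational.Properties
  import Data.Rational.Unnormalised as ℚᵘ
  import Data.Rational.Unnormalised.Properties as ℚᵘ
  open import Level using (0ℓ)
  open import Relation.Nullary.Decidable using (dec⇒maybe)
  open import Relation.Binary.PropositionalEquality
  import Tactic.RingSolver.Core.AlmostCommutativeRing as ACR

  ℚ-ring : ACR.AlmostCommutativeRing 0ℓ 0ℓ
  ℚ-ring = ACR.fromCommutativeRing +-*-commutativeRing λ x → dec⇒maybe (0ℚ ≟ x)

  ℤ→ℚ : ℤ → ℚ
  ℤ→ℚ k = k / 1

  toℚᵘ-ℤ→ℚ : ∀ k → toℚᵘ (ℤ→ℚ k) ℚᵘ.≃ ℚᵘ.mkℚᵘ k 0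
  toℚᵘ-ℤ→ℚ k = toℚᵘ-fromℚᵘ (ℚᵘ.mkℚᵘ k 0)

  ℤ→ℚ-homo-+ : ∀ i j → ℤ→ℚ (i ℤ.+ j) ≡ ℤ→ℚ i + ℤ→ℚ j
  ℤ→ℚ-homo-+ i j = toℚᵘ-injective (ℚᵘ.≃-trans (toℚᵘ-ℤ→ℚ (i ℤ.+ j)) (ℚᵘ.≃-trans (ℚᵘ.*≡* (denominators i j))
    (ℚᵘ.≃-sym (ℚᵘ.≃-trans (toℚᵘ-homo-+ (ℤ→ℚ i) (ℤ→ℚ j)) (ℚᵘ.+-cong (toℚᵘ-ℤ→ℚ i) (toℚᵘ-ℤ→ℚ j))))))
    where
    denominators : ∀ i j → (i ℤ.+ j) ℤ.* (+ 1 ℤ.* + 1) ≡ (i ℤ.* + 1 ℤ.+ j ℤ.* + 1) ℤ.* + 1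
    denominators = ℤ-Solver.solve-∀

  ℤ→ℚ-homo-* : ∀ i j → ℤ→ℚ (i ℤ.* j) ≡ ℤ→ℚ i * ℤ→ℚ j
  ℤ→ℚ-homo-* i j = toℚᵘ-injective (ℚᵘ.≃-trans (toℚᵘ-ℤ→ℚ (i ℤ.* j)) (ℚᵘ.≃-trans (ℚᵘ.*≡* (denominators i j))
    (ℚᵘ.≃-sym (ℚᵘ.≃-trans (toℚᵘ-homo-* (ℤ→ℚ i) (ℤ→ℚ j)) (ℚᵘ.*-cong (toℚᵘ-ℤ→ℚ i) (toℚᵘ-ℤ→ℚ j))))))
    where
    denominators : ∀ i j → (i ℤ.* j) ℤ.* (+ 1 ℤ.* + 1) ≡ (i ℤ.* j) ℤ.* + 1
    denominators = ℤ-Solver.solve-∀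

  ℤ→ℚ-homo‿- : ∀ i → ℤ→ℚ (ℤ.- i) ≡ - ℤ→ℚ i
  ℤ→ℚ-homo‿- i = toℚᵘ-injective (ℚᵘ.≃-trans (toℚᵘ-ℤ→ℚ (ℤ.- i))
    (ℚᵘ.≃-sym (ℚᵘ.≃-trans (toℚᵘ-homo‿- (ℤ→ℚ i)) (ℚᵘ.-‿cong (toℚᵘ-ℤ→ℚ i)))))

  ℤ→ℚ-homo-- : ∀ i j → ℤ→ℚ (i ℤ.- j) ≡ ℤ→ℚ i - ℤ→ℚ j
  ℤ→ℚ-homo-- i j = trans (ℤ→ℚ-homo-+ i (ℤ.- j)) (cong (λ x → ℤ→ℚ i + x) (ℤ→ℚ-homo‿- j))

  ℤ→ℚ-cancel-≤ : ∀ {i j} → ℤ→ℚ i ≤ ℤ→ℚ j → i ℤ.≤ j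
  ℤ→ℚ-cancel-≤ {i} {j} i≤j
    with ℚᵘ.≤-respʳ-≃ (toℚᵘ-ℤ→ℚ j) (ℚᵘ.≤-respˡ-≃ (toℚᵘ-ℤ→ℚ i) (toℚᵘ-mono-≤ i≤j))
  ... | ℚᵘ.*≤* i*1≤j*1 = subst₂ ℤ._≤_ (ℤ.*-identityʳ i) (ℤ.*-identityʳ j) i*1≤j*1

  ℤ→ℚ-mono-< : ∀ {i j} → i ℤ.< j → ℤ→ℚ i < ℤ→ℚ j
  ℤ→ℚ-mono-< {i} {j} i<j = toℚᵘ-cancel-<
    (ℚᵘ.<-respʳ-≃ (ℚᵘ.≃-sym (toℚᵘ-ℤ→ℚ j)) (ℚᵘ.<-respˡ-≃ (ℚᵘ.≃-sym (toℚᵘ-ℤ→ℚ i))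
      (ℚᵘ.*<* (subst₂ ℤ._<_ (sym (ℤ.*-identityʳ i)) (sym (ℤ.*-identityʳ j)) i<j))))

module GoldenField where
  open import Defs
  open import Tactic.RingSolver using (solve-∀)
  open RationalEmbedding
  open Zeckendorf using (fibShiftFrom)
  open import Data.Nat as ℕ using (ℕ; suc)
  import Data.Nat.Properties as ℕ
  open import Data.Integer as ℤ using (ℤ; +_; 0ℤ)
  import Data.Integer.Properties as ℤ
  open import Data.Rational
  open import Data.Rational.Properties using (*-cancelʳ-≤-pos; *-monoˡ-<-pos; <-irrefl; <-≤-trans)
  open import Data.List using ([]; _∷_)
  open import Data.Bool using (true; false)
  open import Data.Product using (_×_; _,_)
  open import Data.Sum using (_⊎_; inj₁; inj₂)
  open import Relation.Nullary using (contradiction)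
  open import Relation.Binary.PropositionalEquality
  open ≡-Reasoning

  ℕ→ℚ : ℕ → ℚ
  ℕ→ℚ n = ℤ→ℚ (+ n)

  ℕ→ℚ-homo-+ : ∀ m n → ℕ→ℚ (m ℕ.+ n) ≡ ℕ→ℚ m + ℕ→ℚ n
  ℕ→ℚ-homo-+ m n = trans (cong ℤ→ℚ (ℤ.pos-+ m n)) (ℤ→ℚ-homo-+ (+ m) (+ n))

  _·β+_ : ℚ → ℚ → Q5
  a ·β+ b = (½ * a + b) ⊕ (½ * a) √5

  ·β+-+ : ∀ a b c d → (a ·β+ b) +₅ (c ·β+ d) ≡ (a + c) ·β+ (b + d)
  ·β+-+ a b c d = cong₂ _⊕_√5 (rational a b c d) (irrational a c)
    where
    rational : ∀ a b c d → (½ * a + b) + (½ * c + d) ≡ ½ * (a + c) + (b + d)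
    rational = solve-∀ ℚ-ring
    irrational : ∀ a c → ½ * a + ½ * c ≡ ½ * (a + c)
    irrational = solve-∀ ℚ-ring

  -- β² = β + 1
  β*·β+ : ∀ a b → β *₅ (a ·β+ b) ≡ (a + b) ·β+ a
  β*·β+ a b = cong₂ _⊕_√5 (rational a b) (irrational a b)
    where
    rational : ∀ a b → ½ * (½ * a + b) + (+ 5 / 1) * (½ * (½ * a)) ≡ ½ * (a + b) + a
    rational = solve-∀ ℚ-ring
    irrational : ∀ a b → ½ * (½ * a) + ½ * (½ * a + b) ≡ ½ * (a + b)
    irrational = solve-∀ ℚ-ring

  β^suc≡fib·β+fib : ∀ m → β ^₅ suc m ≡ ℕ→ℚ (fib (suc m)) ·β+ ℕ→ℚ (fib m)
  β^suc≡fib·β+fib ℕ.zero = refl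
  β^suc≡fib·β+fib (suc m) = begin
    β *₅ (β ^₅ suc m)                                       ≡⟨ cong (β *₅_) (β^suc≡fib·β+fib m) ⟩
    β *₅ (ℕ→ℚ (fib (suc m)) ·β+ ℕ→ℚ (fib m))               ≡⟨ β*·β+ (ℕ→ℚ (fib (suc m))) (ℕ→ℚ (fib m)) ⟩
    (ℕ→ℚ (fib (suc m)) + ℕ→ℚ (fib m)) ·β+ ℕ→ℚ (fib (suc m)) ≡⟨ cong (_·β+ ℕ→ℚ (fib (suc m))) (ℕ→ℚ-homo-+ (fib (suc m)) (fib m)) ⟨
    ℕ→ℚ (fib (suc (suc m))) ·β+ ℕ→ℚ (fib (suc m))           ∎

  betaSumFrom≡zvalFrom·β+fibShiftFrom : ∀ j es →
    betaSumFrom j es ≡ ℕ→ℚ (zvalFrom j es) ·β+ ℕ→ℚ (fibShiftFrom j es)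
  betaSumFrom≡zvalFrom·β+fibShiftFrom j [] = refl
  betaSumFrom≡zvalFrom·β+fibShiftFrom j (false ∷ es) = betaSumFrom≡zvalFrom·β+fibShiftFrom (suc j) es
  betaSumFrom≡zvalFrom·β+fibShiftFrom j (true ∷ es) = begin
    β ^₅ suc (suc j) +₅ betaSumFrom (suc j) es
      ≡⟨ cong₂ _+₅_ (β^suc≡fib·β+fib (suc j)) (betaSumFrom≡zvalFrom·β+fibShiftFrom (suc j) es) ⟩
    (ℕ→ℚ F₂ ·β+ ℕ→ℚ F₁) +₅ (ℕ→ℚ Z ·β+ ℕ→ℚ P)  ≡⟨ ·β+-+ (ℕ→ℚ F₂) (ℕ→ℚ F₁) (ℕ→ℚ Z) (ℕ→ℚ P) ⟩
    (ℕ→ℚ F₂ + ℕ→ℚ Z) ·β+ (ℕ→ℚ F₁ + ℕ→ℚ P)       ≡⟨ cong₂ _·β+_ (ℕ→ℚ-digit F₂ Z) (ℕ→ℚ-digit F₁ P) ⟨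
    ℕ→ℚ (1 ℕ.* F₂ ℕ.+ Z) ·β+ ℕ→ℚ (1 ℕ.* F₁ ℕ.+ P) ∎
    where
    F₂ = fib (suc (suc j))
    F₁ = fib (suc j)
    Z = zvalFrom (suc j) es
    P = fibShiftFrom (suc j) es
    ℕ→ℚ-digit : ∀ x y → ℕ→ℚ (1 ℕ.* x ℕ.+ y) ≡ ℕ→ℚ x + ℕ→ℚ y
    ℕ→ℚ-digit x y = trans (cong (λ z → ℕ→ℚ (z ℕ.+ y)) (ℕ.*-identityˡ x)) (ℕ→ℚ-homo-+ x y)

  δ-formula : ∀ n P f q k → suc q ≡ f ℕ.+ P → k ≡ + (n ℕ.+ q) →
    div√5 (ℕ→ℚ n ·β+ ℕ→ℚ P) ≡ ℕ→Q5 n -₅ div√5 ((β *₅ ℕ→Q5 n) -₅ ℤ→Q5 k -₅ 1₅ +₅ ℕ→Q5 f)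
  δ-formula n P f q k 1+q≡f+P refl = cong₂ _⊕_√5 (rational N) (begin
    (½ * N + ℕ→ℚ P) * (+ 1 / 5)                     ≡⟨ cong (λ P → (½ * N + P) * (+ 1 / 5)) P≡K+1-N-F ⟩
    (½ * N + ((K + 1ℚ) - N - F)) * (+ 1 / 5)        ≡⟨ irrational N F K ⟩
    0ℚ - (½ * N + + 5 / 1 * (½ * 0ℚ) - K - 1ℚ + F) * (+ 1 / 5) ∎)
    where
    N = ℕ→ℚ n
    F = ℕ→ℚ f
    K = ℕ→ℚ (n ℕ.+ q)
    rational : ∀ n → ½ * n ≡ n - ((½ * 0ℚ + ½ * n - 0ℚ) - 0ℚ + 0ℚ)
    rational = solve-∀ ℚ-ring
    irrational : ∀ n f k → (½ * n + ((k + 1ℚ) - n - f)) * (+ 1 / 5)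
                          ≡ 0ℚ - (½ * n + + 5 / 1 * (½ * 0ℚ) - k - 1ℚ + f) * (+ 1 / 5)
    irrational = solve-∀ ℚ-ring
    cancel : ∀ n f P → P ≡ (n + (f + P)) - n - f
    cancel = solve-∀ ℚ-ring
    K+1≡N+F+P : K + 1ℚ ≡ N + (F + ℕ→ℚ P)
    K+1≡N+F+P = begin
      K + 1ℚ                    ≡⟨ ℕ→ℚ-homo-+ (n ℕ.+ q) 1 ⟨
      ℕ→ℚ (n ℕ.+ q ℕ.+ 1)       ≡⟨ cong ℕ→ℚ (trans (ℕ.+-assoc n q 1) (cong (n ℕ.+_) (trans (ℕ.+-comm q 1) 1+q≡f+P))) ⟩
      ℕ→ℚ (n ℕ.+ (f ℕ.+ P))     ≡⟨ trans (ℕ→ℚ-homo-+ n (f ℕ.+ P)) (cong (λ x → N + x) (ℕ→ℚ-homo-+ f P)) ⟩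
      N + (F + ℕ→ℚ P)           ∎
    P≡K+1-N-F : ℕ→ℚ P ≡ (K + 1ℚ) - N - F
    P≡K+1-N-F = trans (cancel N F (ℕ→ℚ P)) (cong (λ x → x - N - F) (sym K+1≡N+F+P))

  nonNeg₅⇒0≤a⊎a²≤5b² : ∀ {a b} → NonNeg₅ (a ⊕ b √5) → 0ℚ ≤ a ⊎ a * a ≤ + 5 / 1 * (b * b)
  nonNeg₅⇒0≤a⊎a²≤5b² (inj₁ (0≤a , _)) = inj₁ 0≤a
  nonNeg₅⇒0≤a⊎a²≤5b² (inj₂ (inj₁ (0≤a , _ , _))) = inj₁ 0≤a
  nonNeg₅⇒0≤a⊎a²≤5b² (inj₂ (inj₂ (_ , _ , a²≤5b²))) = inj₂ a²≤5b²

  nonNeg₅⇒0≤a×5b²≤a² : ∀ {a b} → b < 0ℚ → NonNeg₅ (a ⊕ b √5) → 0ℚ ≤ a × + 5 / 1 * (b * b) ≤ a * a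
  nonNeg₅⇒0≤a×5b²≤a² b<0 (inj₁ (_ , 0≤b)) = contradiction (<-≤-trans b<0 0≤b) (<-irrefl refl)
  nonNeg₅⇒0≤a×5b²≤a² b<0 (inj₂ (inj₁ (0≤a , _ , 5b²≤a²))) = 0≤a , 5b²≤a²
  nonNeg₅⇒0≤a×5b²≤a² b<0 (inj₂ (inj₂ (_ , 0≤b , _))) = contradiction (<-≤-trans b<0 0≤b) (<-irrefl refl)

  half₅ : ℤ → ℤ → Q5
  half₅ a b = (ℤ→ℚ a * ½) ⊕ (ℤ→ℚ b * ½) √5

  ¼ : ℚ
  ¼ = ½ * ½

  ℤ→ℚ-*¼-cancel-≤ : ∀ {i j} → ℤ→ℚ i * ¼ ≤ ℤ→ℚ j * ¼ → i ℤ.≤ j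
  ℤ→ℚ-*¼-cancel-≤ i¼≤j¼ = ℤ→ℚ-cancel-≤ (*-cancelʳ-≤-pos ¼ i¼≤j¼)

  sq-half : ∀ i → (ℤ→ℚ i * ½) * (ℤ→ℚ i * ½) ≡ ℤ→ℚ (i ℤ.* i) * ¼
  sq-half i = trans (rearrange (ℤ→ℚ i)) (cong (_* ¼) (sym (ℤ→ℚ-homo-* i i)))
    where
    rearrange : ∀ x → (x * ½) * (x * ½) ≡ (x * x) * (½ * ½)
    rearrange = solve-∀ ℚ-ring

  five-sq-half : ∀ i → + 5 / 1 * ((ℤ→ℚ i * ½) * (ℤ→ℚ i * ½)) ≡ ℤ→ℚ (+ 5 ℤ.* (i ℤ.* i)) * ¼
  five-sq-half i = begin
    + 5 / 1 * ((ℤ→ℚ i * ½) * (ℤ→ℚ i * ½)) ≡⟨ cong (+ 5 / 1 *_) (sq-half i) ⟩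
    + 5 / 1 * (ℤ→ℚ (i ℤ.* i) * ¼)           ≡⟨ reassociate (ℤ→ℚ (i ℤ.* i)) ⟩
    (+ 5 / 1 * ℤ→ℚ (i ℤ.* i)) * ¼           ≡⟨ cong (_* ¼) (ℤ→ℚ-homo-* (+ 5) (i ℤ.* i)) ⟨
    ℤ→ℚ (+ 5 ℤ.* (i ℤ.* i)) * ¼             ∎
    where
    reassociate : ∀ x → + 5 / 1 * (x * (½ * ½)) ≡ (+ 5 / 1 * x) * (½ * ½)
    reassociate = solve-∀ ℚ-ring

  nonNeg₅-half₅⇒ : ∀ a b → NonNeg₅ (half₅ a b) → 0ℤ ℤ.≤ a ⊎ a ℤ.* a ℤ.≤ + 5 ℤ.* (b ℤ.* b)
  nonNeg₅-half₅⇒ a b a+b√5≥0 with nonNeg₅⇒0≤a⊎a²≤5b² a+b√5≥0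
  ... | inj₁ 0≤a/2 = inj₁ (ℤ→ℚ-cancel-≤ (*-cancelʳ-≤-pos ½ 0≤a/2))
  ... | inj₂ a²≤5b² = inj₂ (ℤ→ℚ-*¼-cancel-≤ (subst₂ _≤_ (sq-half a) (five-sq-half b) a²≤5b²))

  nonNeg₅-half₅⇒-neg : ∀ a b → b ℤ.< 0ℤ → NonNeg₅ (half₅ a b) → 0ℤ ℤ.≤ a × + 5 ℤ.* (b ℤ.* b) ℤ.≤ a ℤ.* a
  nonNeg₅-half₅⇒-neg a b b<0 a+b√5≥0 with nonNeg₅⇒0≤a×5b²≤a² (*-monoˡ-<-pos ½ (ℤ→ℚ-mono-< b<0)) a+b√5≥0
  ... | 0≤a/2 , 5b²≤a² =
    ℤ→ℚ-cancel-≤ (*-cancelʳ-≤-pos ½ 0≤a/2) , ℤ→ℚ-*¼-cancel-≤ (subst₂ _≤_ (five-sq-half b) (sq-half a) 5b²≤a²)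

  βn-k≡half₅ : ∀ n k → (β *₅ ℕ→Q5 n) -₅ ℤ→Q5 k ≡ half₅ (+ n ℤ.- + 2 ℤ.* k) (+ n)
  βn-k≡half₅ n k = cong₂ _⊕_√5
    (trans (rational (ℕ→ℚ n) (ℤ→ℚ k))
      (cong (_* ½) (sym (trans (ℤ→ℚ-homo-- (+ n) (+ 2 ℤ.* k)) (cong (λ x → ℕ→ℚ n - x) (ℤ→ℚ-homo-* (+ 2) k))))))
    (irrational (ℕ→ℚ n))
    where
    rational : ∀ n k → ½ * n + + 5 / 1 * (½ * 0ℚ) - k ≡ (n - + 2 / 1 * k) * ½
    rational = solve-∀ ℚ-ring
    irrational : ∀ n → ½ * 0ℚ + ½ * n - 0ℚ ≡ n * ½
    irrational = solve-∀ ℚ-ring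

  k+1-βn≡half₅ : ∀ n k → ℤ→Q5 (k ℤ.+ + 1) -₅ (β *₅ ℕ→Q5 n) ≡ half₅ (+ 2 ℤ.* k ℤ.- + n ℤ.+ + 2) (ℤ.- + n)
  k+1-βn≡half₅ n k = cong₂ _⊕_√5
    (begin
      ℤ→ℚ (k ℤ.+ + 1) - (½ * ℕ→ℚ n + + 5 / 1 * (½ * 0ℚ)) ≡⟨ cong (_- _) (ℤ→ℚ-homo-+ k (+ 1)) ⟩
      (ℤ→ℚ k + 1ℚ) - (½ * ℕ→ℚ n + + 5 / 1 * (½ * 0ℚ))   ≡⟨ rational (ℕ→ℚ n) (ℤ→ℚ k) ⟩
      (+ 2 / 1 * ℤ→ℚ k - ℕ→ℚ n + + 2 / 1) * ½            ≡⟨ cong (_* ½) homs ⟨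
      ℤ→ℚ (+ 2 ℤ.* k ℤ.- + n ℤ.+ + 2) * ½                 ∎)
    (trans (irrational (ℕ→ℚ n)) (cong (_* ½) (sym (ℤ→ℚ-homo‿- (+ n)))))
    where
    rational : ∀ n k → (k + 1ℚ) - (½ * n + + 5 / 1 * (½ * 0ℚ)) ≡ (+ 2 / 1 * k - n + + 2 / 1) * ½
    rational = solve-∀ ℚ-ring
    irrational : ∀ n → 0ℚ - (½ * 0ℚ + ½ * n) ≡ (- n) * ½
    irrational = solve-∀ ℚ-ring
    homs : ℤ→ℚ (+ 2 ℤ.* k ℤ.- + n ℤ.+ + 2) ≡ + 2 / 1 * ℤ→ℚ k - ℕ→ℚ n + + 2 / 1
    homs = trans (ℤ→ℚ-homo-+ (+ 2 ℤ.* k ℤ.- + n) (+ 2))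
      (cong (_+ + 2 / 1) (trans (ℤ→ℚ-homo-- (+ 2 ℤ.* k) (+ n)) (cong (_- ℕ→ℚ n) (ℤ→ℚ-homo-* (+ 2) k))))

module FloorOfGoldenMultiple where
  open import Defs
  open GoldenField using (nonNeg₅-half₅⇒; nonNeg₅-half₅⇒-neg; βn-k≡half₅; k+1-βn≡half₅)
  open Beatty using (⌊_/β⌋≡_; m*m<n*n⇒m<n)
  open import Data.Nat as ℕ using (ℕ)
  open import Data.Integer
  open import Data.Integer.Properties
  open import Data.Integer.Tactic.RingSolver using (solve-∀)
  open import Data.Product using (_×_; _,_; proj₁; proj₂)
  open import Data.Sum using (_⊎_; inj₁; inj₂)
  open import Relation.Binary.PropositionalEquality
  open ≤-Reasoning

  i*i<j*j⇒i<j : ∀ {i j} → 0ℤ ≤ j → i * i < j * j → i < j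
  i*i<j*j⇒i<j {+ m} {+ n} _ i*i<j*j =
    +<+ (m*m<n*n⇒m<n (drop‿+<+ (subst₂ _<_ (sym (pos-* m m)) (sym (pos-* n n)) i*i<j*j)))
  i*i<j*j⇒i<j { -[1+ m ]} {+ n} _ _ = -<+

  2i-n<2j-n+2⇒i≤j : ∀ i j n → + 2 * i - n < + 2 * j - n + + 2 → i ≤ j
  2i-n<2j-n+2⇒i≤j i j n 2i-n<2j-n+2 = begin
    i                 ≤⟨ i<j⇒i≤pred[j] (*-cancelˡ-<-nonNeg (+ 2) 2i<2[j+1]) ⟩
    pred (j + + 1)    ≡⟨ pred[j+1]≡j j ⟩
    j                 ∎
    where
    cancel : ∀ i n → (+ 2 * i - n) + n ≡ + 2 * i
    cancel = solve-∀
    cancel′ : ∀ j n → (+ 2 * j - n + + 2) + n ≡ + 2 * (j + + 1)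
    cancel′ = solve-∀
    2i<2[j+1] : + 2 * i < + 2 * (j + + 1)
    2i<2[j+1] = subst₂ _<_ (cancel i n) (cancel′ j n) (+-monoˡ-< n 2i-n<2j-n+2)
    pred[j+1]≡j : ∀ j → -1ℤ + (j + + 1) ≡ j
    pred[j+1]≡j = solve-∀

  ⌊/β⌋≡⇒ℤ-bounds : ∀ n q → ⌊ n /β⌋≡ q →
    let r = + 2 * + (n ℕ.+ q) - + n in
    0ℤ < r + + 2 × r * r < + 5 * (+ n * + n) × + 5 * (+ n * + n) < (r + + 2) * (r + + 2)
  ⌊/β⌋≡⇒ℤ-bounds n q (q<n/β , n/β<1+q) =
    subst (0ℤ <_) s≡r+2 (+<+ (ℕ.s≤s ℕ.z≤n)) ,
    subst₂ _<_ (trans (pos-* (2 ℕ.* q ℕ.+ n) (2 ℕ.* q ℕ.+ n)) (cong₂ _*_ r≡ r≡)) 5n²≡ (+<+ q<n/β) ,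
    subst₂ _<_ 5n²≡ (trans (pos-* (2 ℕ.* ℕ.suc q ℕ.+ n) (2 ℕ.* ℕ.suc q ℕ.+ n)) (cong₂ _*_ s≡r+2 s≡r+2)) (+<+ n/β<1+q)
    where
    r = + 2 * + (n ℕ.+ q) - + n
    5n²≡ : + (5 ℕ.* (n ℕ.* n)) ≡ + 5 * (+ n * + n)
    5n²≡ = trans (pos-* 5 (n ℕ.* n)) (cong (+ 5 *_) (pos-* n n))
    2q+n≡r : + 2 * + q + + n ≡ r
    2q+n≡r = trans (linear (+ n) (+ q)) (cong (λ x → + 2 * x - + n) (sym (pos-+ n q)))
      where
      linear : ∀ n q → + 2 * q + n ≡ + 2 * (n + q) - n
      linear = solve-∀
    r≡ : + (2 ℕ.* q ℕ.+ n) ≡ r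
    r≡ = trans (trans (pos-+ (2 ℕ.* q) n) (cong (_+ + n) (pos-* 2 q))) 2q+n≡r
    s≡r+2 : + (2 ℕ.* ℕ.suc q ℕ.+ n) ≡ r + + 2
    s≡r+2 = begin-equality
      + (2 ℕ.* ℕ.suc q ℕ.+ n)    ≡⟨ trans (pos-+ (2 ℕ.* ℕ.suc q) n) (cong (_+ + n) (pos-* 2 (ℕ.suc q))) ⟩
      + 2 * + (1 ℕ.+ q) + + n    ≡⟨ cong (λ x → + 2 * x + + n) (pos-+ 1 q) ⟩
      + 2 * (+ 1 + + q) + + n    ≡⟨ shift (+ q) (+ n) ⟩
      + 2 * + q + + n + + 2      ≡⟨ cong (_+ + 2) 2q+n≡r ⟩
      r + + 2                    ∎
      where
      shift : ∀ q n → + 2 * (+ 1 + q) + n ≡ + 2 * q + n + + 2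
      shift = solve-∀

  -- The last two hypotheses are k ≤ βn ≤ k + 1, doubled and squared: 2k − n ≤ √5 n ≤ 2k + 2 − n.
  k≡n+⌊n/β⌋ : ∀ n q k → ⌊ n /β⌋≡ q →
    0ℤ ≤ + n - + 2 * k ⊎ (+ n - + 2 * k) * (+ n - + 2 * k) ≤ + 5 * (+ n * + n) →
    0ℤ ≤ + 2 * k - + n + + 2 × + 5 * (- + n * - + n) ≤ (+ 2 * k - + n + + 2) * (+ 2 * k - + n + + 2) →
    k ≡ + (n ℕ.+ q)
  k≡n+⌊n/β⌋ n q k ⌊n/β⌋≡q 2k-n≤√5n (0≤2k-n+2 , √5n≤2k-n+2) =
    ≤-antisym (2i-n<2j-n+2⇒i≤j k (+ (n ℕ.+ q)) (+ n) (2k-n<r+2 2k-n≤√5n))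
              (2i-n<2j-n+2⇒i≤j (+ (n ℕ.+ q)) k (+ n) r<2k-n+2)
    where
    N = + 5 * (+ n * + n)
    r = + 2 * + (n ℕ.+ q) - + n
    bounds = ⌊/β⌋≡⇒ℤ-bounds n q ⌊n/β⌋≡q
    0<r+2 = proj₁ bounds
    r²<N = proj₁ (proj₂ bounds)
    N<[r+2]² = proj₂ (proj₂ bounds)

    2k-n<r+2 : 0ℤ ≤ + n - + 2 * k ⊎ (+ n - + 2 * k) * (+ n - + 2 * k) ≤ N → + 2 * k - + n < r + + 2
    2k-n<r+2 (inj₁ 0≤n-2k) = ≤-<-trans (subst (_≤ 0ℤ) (negate (+ n) k) (neg-mono-≤ 0≤n-2k)) 0<r+2
      where
      negate : ∀ n k → - (n - + 2 * k) ≡ + 2 * k - n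
      negate = solve-∀
    2k-n<r+2 (inj₂ [n-2k]²≤N) =
      i*i<j*j⇒i<j (<⇒≤ 0<r+2) (≤-<-trans (≤-trans (≤-reflexive (flip (+ n) k)) [n-2k]²≤N) N<[r+2]²)
      where
      flip : ∀ n k → (+ 2 * k - n) * (+ 2 * k - n) ≡ (n - + 2 * k) * (n - + 2 * k)
      flip = solve-∀

    r<2k-n+2 : r < + 2 * k - + n + + 2
    r<2k-n+2 = i*i<j*j⇒i<j 0≤2k-n+2 (<-≤-trans r²<N (≤-trans (≤-reflexive (square-neg (+ n))) √5n≤2k-n+2))
      where
      square-neg : ∀ n → + 5 * (n * n) ≡ + 5 * (- n * - n)
      square-neg = solve-∀

  -n<0 : ∀ {n} → 1 ℕ.≤ n → - + n < 0ℤ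
  -n<0 (ℕ.s≤s ℕ.z≤n) = -<+

  ⌊βn⌋≡n+⌊n/β⌋ : ∀ n q k → 1 ℕ.≤ n → ⌊ n /β⌋≡ q →
    ℤ→Q5 k ≤₅ (β *₅ ℕ→Q5 n) → (β *₅ ℕ→Q5 n) ≤₅ ℤ→Q5 (k + + 1) → k ≡ + (n ℕ.+ q)
  ⌊βn⌋≡n+⌊n/β⌋ n q k 1≤n ⌊n/β⌋≡q k≤βn βn≤k+1 = k≡n+⌊n/β⌋ n q k ⌊n/β⌋≡q
    (nonNeg₅-half₅⇒ (+ n - + 2 * k) (+ n) (subst NonNeg₅ (βn-k≡half₅ n k) k≤βn))
    (nonNeg₅-half₅⇒-neg (+ 2 * k - + n + + 2) (- + n) (-n<0 1≤n) (subst NonNeg₅ (k+1-βn≡half₅ n k) βn≤k+1))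

open import Defs
open import Data.Nat using (ℕ; _≥_)
open import Data.Integer using (ℤ; _+_; +_)
open import Data.List using (List)
open import Data.Bool using (Bool)
open import Relation.Binary.PropositionalEquality using (_≡_)

import Data.Nat as ℕ
open import Data.Product using (_,_)
open import Relation.Binary.PropositionalEquality using (refl; cong; trans; sym)
open Zeckendorf using (fibShift)
open FibonacciWord using (fword-zvalFrom)
open Beatty using (⌊zval/β⌋)
open GoldenField using (betaSumFrom≡zvalFrom·β+fibShiftFrom; δ-formula)
open FloorOfGoldenMultiple using (⌊βn⌋≡n+⌊n/β⌋)

proposition11 : (n : ℕ) → n ≥ 1 → (ε : List Bool) → IsZeckendorf n ε →
    (k : ℤ) → ℤ→Q5 k ≤₅ (β *₅ ℕ→Q5 n) → (β *₅ ℕ→Q5 n) <₅ ℤ→Q5 (k + + 1) →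
    δ ε ≡ ℕ→Q5 n -₅ div√5 (((β *₅ ℕ→Q5 n) -₅ ℤ→Q5 k) -₅ 1₅ +₅ ℕ→Q5 (fword n))
proposition11 .(zval ε) 1≤n ε (noAdj11 , refl) k k≤βn (βn≤k+1 , _) with ⌊zval/β⌋ ε 1≤n
... | q , 1+q≡f+P , ⌊n/β⌋≡q =
  trans (cong div√5 (betaSumFrom≡zvalFrom·β+fibShiftFrom 0 ε))
        (δ-formula (zval ε) (fibShift ε) (fword (zval ε)) q k 1+q≡fword+P k≡n+q)
  where
  1+q≡fword+P : ℕ.suc q ≡ fword (zval ε) ℕ.+ fibShift ε
  1+q≡fword+P = trans 1+q≡f+P (cong (ℕ._+ fibShift ε) (sym (fword-zvalFrom 0 ε noAdj11 1≤n)))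
  k≡n+q : k ≡ + (zval ε ℕ.+ q)
  k≡n+q = ⌊βn⌋≡n+⌊n/β⌋ (zval ε) q k 1≤n ⌊n/β⌋≡q k≤βn βn≤k+1
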